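{- Let $r\ge2$ and let $F,H$ be non-isomorphic $r$-uniform hypergraphs without isolated vertices. Then there exists a hypergraph $X$ that is a sub-hypergraph of $F$ or of $H$ such that $\#\mathrm{Hom}(F\to X)\ne\#\mathrm{Hom}(H\to X)$.
   Context: Hypergraphs have a finite vertex set and a set of nonempty vertex subsets as hyperedges; $r$-uniform means all hyperedges have size $r$. A sub-hypergraph of $G$ is always hyperedge-induced: for $A\subseteq E(G)$, $G[A]$ has vertex set $\bigcup_{e\in A}e$ and hyperedge set $A$. A homomorphism $F\to G$ is a map $h:V(F)\to V(G)$ with $\{h(v):v\in e\}\in E(G)$ for all $e\in E(F)$; $\#\mathrm{Hom}(F\to G)$ is their number. -}

module Defs where

open import Data.Nat using (ℕ; zero; suc)
open import Data.Bool using (Bool; true; false; _∧_; _∨_; not)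
open import Data.Fin using (Fin; zero; suc; _≟_)
open import Data.Fin.Subset using (Subset; _∈_; ∣_∣)
open import Data.Vec using (Vec; []; _∷_; tabulate; lookup)
open import Data.List using (List; []; _∷_; map; concatMap; filterᵇ; length; _++_; allFin)
open import Data.Product using (Σ; ∃; _×_; _,_)
open import Relation.Binary.PropositionalEquality using (_≡_)
open import Relation.Nullary using (¬_)
open import Relation.Nullary.Decidable using (⌊_⌋)
open import Function.Definitions using (Injective)

record Hypergraph : Set where
  field
    n : ℕ
    E : Subset n → Bool
open Hypergraph public

IsEdge : (G : Hypergraph) → Subset (n G) → Set
IsEdge G e = E G e ≡ true

Wellformed : Hypergraph → Set
Wellformed G = ∀ e → IsEdge G e → ¬ (∣ e ∣ ≡ 0)

Uniform : ℕ → Hypergraph → Set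
Uniform r G = ∀ e → IsEdge G e → ∣ e ∣ ≡ r

NoIsolated : Hypergraph → Set
NoIsolated G = ∀ (v : Fin (n G)) → ∃ λ e → IsEdge G e × v ∈ e

anyFin : ∀ {k} → (Fin k → Bool) → Bool
anyFin {zero}  p = false
anyFin {suc k} p = p zero ∨ anyFin (λ i → p (suc i))

image : ∀ {a b} → (Fin a → Fin b) → Subset a → Subset b
image h e = tabulate λ j → anyFin λ i → lookup e i ∧ ⌊ h i ≟ j ⌋

IsHom : (F G : Hypergraph) → (Fin (n F) → Fin (n G)) → Set
IsHom F G h = ∀ e → IsEdge F e → IsEdge G (image h e)

Isomorphic : Hypergraph → Hypergraph → Set
Isomorphic F G =
  Σ (Fin (n F) → Fin (n G)) λ φ →
  Σ (Fin (n G) → Fin (n F)) λ ψ →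
    (∀ x → ψ (φ x) ≡ x) × (∀ y → φ (ψ y) ≡ y)
    × (∀ e → E F e ≡ E G (image φ e))

-- X is (isomorphic to) a hyperedge-induced sub-hypergraph G[A] of G:
-- X has no isolated vertices and embeds injectively into G sending
-- hyperedges to hyperedges (then X ≅ G[A] with A = φ(E(X))).
SubHypergraph : Hypergraph → Hypergraph → Set
SubHypergraph X G =
  Wellformed X × NoIsolated X ×
  Σ (Fin (n X) → Fin (n G)) λ φ → Injective _≡_ _≡_ φ × IsHom X G φ

allSubsets : (k : ℕ) → List (Subset k)
allSubsets zero    = [] ∷ []
allSubsets (suc k) = concatMap (λ s → (false ∷ s) ∷ (true ∷ s) ∷ []) (allSubsets k)

allFuns : (a b : ℕ) → List (Fin a → Fin b)
allFuns zero    b = (λ ()) ∷ []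
allFuns (suc a) b = concatMap (λ f → map (λ j → extend j f) (allFin b)) (allFuns a b)
  where
  extend : Fin b → (Fin a → Fin b) → Fin (suc a) → Fin b
  extend j f zero    = j
  extend j f (suc i) = f i

allᵇ : ∀ {A : Set} → (A → Bool) → List A → Bool
allᵇ p []       = true
allᵇ p (x ∷ xs) = p x ∧ allᵇ p xs

isHomᵇ : (F G : Hypergraph) → (Fin (n F) → Fin (n G)) → Bool
isHomᵇ F G h = allᵇ (λ e → not (E F e) ∨ E G (image h e)) (allSubsets (n F))

homCount : Hypergraph → Hypergraph → ℕ
homCount F G = length (filterᵇ (isHomᵇ F G) (allFuns (n F) (n G)))

module Submission where

-- Inclusion–exclusion over the hyperedges of G: if hom(F, X) = hom(H, X) for every
-- sub-hypergraph X of G, then F and H have equally many homomorphisms into G whose images hit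
-- every hyperedge of G.  It runs without subtraction: the homomorphisms into the hyperedge set A
-- hitting all of C are those hitting c ∷ C plus those into A without c hitting C.  Isolated
-- vertices of the target do not change the number of homomorphisms from F or H, so the spanning
-- sub-hypergraph with hyperedges A may be replaced by the sub-hypergraph G[A].  For G = F and
-- G = H the identity is such a homomorphism, so there are edge-surjective homomorphisms H → F and
-- F → H.  Having no isolated vertices, they are onto on vertices, hence bijective, and F → H is
-- an isomorphism.

open import Defs
open import Data.Nat using (ℕ; zero; suc; _+_; _≤_)
import Data.Nat as ℕ
open import Data.Nat.Properties using (+-suc; +-cancelʳ-≡; <⇒≤; 1+n≰n)
open import Data.Nat.ListAction using (sum)
open import Data.Nat.ListAction.Properties using (sum-++)
open import Data.Bool using (Bool; true; false; _∧_; _∨_; not; T; if_then_else_)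
import Data.Bool as Bool
open import Data.Bool.Properties using (⇔→≡; ∧-identityʳ; ∧-zeroʳ; T-≡)
open import Data.Bool.ListAction using (any)
open import Data.Fin using (Fin; zero; suc; _≟_)
open import Data.Fin.Properties using (suc-injective; injective⇒≤)
open import Data.Fin.Subset using (Subset; _∈_; _∉_; ∣_∣; Empty; ⊥)
open import Data.Fin.Subset.Properties using (⊆-antisym; Empty-unique; ∣⊥∣≡0; drop-there)
open import Data.Vec using ([]; _∷_; here; there; lookup; tabulate)
open import Data.Vec.Properties using (lookup∘tabulate; []=⇒lookup; lookup⇒[]=; ≡-dec)
import Data.Vec.Functional as Vector
open import Data.List using (List; []; _∷_; _++_; map; concatMap; filterᵇ; length; allFin)
import Data.List as List
open import Data.List.Properties using (map-cong; map-∘; map-++; map-tabulate; tabulate-cong)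
open import Data.List.Membership.Propositional using (lose) renaming (_∈_ to _∈ₗ_)
open import Data.List.Membership.Propositional.Properties
  using (∈-concatMap⁺; ∈-map⁺; ∈-allFin; ∈-filter⁺; ∈-filter⁻)
open import Data.List.Relation.Unary.Any using (here; there; satisfied)
open import Data.List.Relation.Unary.Any.Properties using (any⁺; any⁻)
open import Data.Product using (∃; _×_; _,_; proj₁; proj₂)
open import Data.Sum using (_⊎_; inj₁; inj₂)
open import Function using (_∘_; id; mk⇔; Equivalence)
open import Function.Definitions using (Injective)
open import Relation.Binary.PropositionalEquality
open import Relation.Nullary using (¬_; Dec; yes; no; contradiction)
open import Relation.Nullary.Decidable using (⌊_⌋; toWitness; fromWitness)

private variable
  A B : Set
  a b k m : ℕ

T⇒≡true : ∀ {x} → T x → x ≡ true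
T⇒≡true = Equivalence.to T-≡

≡true⇒T : ∀ {x} → x ≡ true → T x
≡true⇒T = Equivalence.from T-≡

∧-true⁻ : ∀ {x y} → x ∧ y ≡ true → x ≡ true × y ≡ true
∧-true⁻ {true} y≡true = refl , y≡true

∧-true⁺ : ∀ {x y} → x ≡ true → y ≡ true → x ∧ y ≡ true
∧-true⁺ refl refl = refl

not∨-true⁻ : ∀ {x y} → not x ∨ y ≡ true → x ≡ true → y ≡ true
not∨-true⁻ y≡true refl = y≡true

not∨-true⁺ : ∀ {x y} → (x ≡ true → y ≡ true) → not x ∨ y ≡ true
not∨-true⁺ {false} _ = refl
not∨-true⁺ {true} x⇒y = x⇒y refl

⌊⌋-true⁻ : ∀ {P : Set} {P? : Dec P} → ⌊ P? ⌋ ≡ true → P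
⌊⌋-true⁻ = toWitness ∘ ≡true⇒T

⌊⌋-true⁺ : ∀ {P : Set} {P? : Dec P} → P → ⌊ P? ⌋ ≡ true
⌊⌋-true⁺ = T⇒≡true ∘ fromWitness

any-true⁻ : ∀ (p : A → Bool) xs → any p xs ≡ true → ∃ λ x → p x ≡ true
any-true⁻ p xs t = let x , px = satisfied (any⁻ p xs (≡true⇒T t)) in x , T⇒≡true px

any-true⁺ : ∀ (p : A → Bool) {x xs} → x ∈ₗ xs → p x ≡ true → any p xs ≡ true
any-true⁺ p x∈xs px = T⇒≡true (any⁺ p (lose x∈xs (≡true⇒T px)))

allᵇ-true⁻ : ∀ {p : A → Bool} {x xs} → allᵇ p xs ≡ true → x ∈ₗ xs → p x ≡ true
allᵇ-true⁻ t (here refl) = proj₁ (∧-true⁻ t)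
allᵇ-true⁻ {p = p} {xs = y ∷ _} t (there x∈xs) =
  allᵇ-true⁻ (proj₂ (∧-true⁻ {p y} t)) x∈xs

allᵇ-true⁺ : ∀ {p : A → Bool} xs → (∀ {x} → x ∈ₗ xs → p x ≡ true) → allᵇ p xs ≡ true
allᵇ-true⁺ [] _ = refl
allᵇ-true⁺ (x ∷ xs) all = ∧-true⁺ (all (here refl)) (allᵇ-true⁺ xs (all ∘ there))

allᵇ-cong : ∀ {p q : A → Bool} → (∀ x → p x ≡ q x) → ∀ xs → allᵇ p xs ≡ allᵇ q xs
allᵇ-cong p≗q [] = refl
allᵇ-cong p≗q (x ∷ xs) = cong₂ _∧_ (p≗q x) (allᵇ-cong p≗q xs)

allᵇ-guarded-∧-not : ∀ (s p d : A → Bool) xs →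
  allᵇ (λ x → not (s x) ∨ (p x ∧ not (d x))) xs
    ≡ allᵇ (λ x → not (s x) ∨ p x) xs ∧ not (any (λ x → s x ∧ d x) xs)
allᵇ-guarded-∧-not s p d [] = refl
allᵇ-guarded-∧-not s p d (x ∷ xs)
  rewrite allᵇ-guarded-∧-not s p d xs with s x | p x | d x
... | false | _     | _     = refl
... | true  | false | _     = refl
... | true  | true  | false = refl
... | true  | true  | true  = sym (∧-zeroʳ _)

count : (A → Bool) → List A → ℕ
count P xs = length (filterᵇ P xs)

indicator : Bool → ℕ
indicator b = if b then 1 else 0

count≡sum : ∀ (P : A → Bool) xs → count P xs ≡ sum (map (indicator ∘ P) xs)
count≡sum P [] = refl
count≡sum P (x ∷ xs) with P x
... | true  = cong suc (count≡sum P xs)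
... | false = count≡sum P xs

count-cong : ∀ {P Q : A → Bool} → (∀ x → P x ≡ Q x) → ∀ xs → count P xs ≡ count Q xs
count-cong {P = P} {Q} P≗Q xs = begin
  count P xs                    ≡⟨ count≡sum P xs ⟩
  sum (map (indicator ∘ P) xs)  ≡⟨ cong sum (map-cong (cong indicator ∘ P≗Q) xs) ⟩
  sum (map (indicator ∘ Q) xs)  ≡⟨ count≡sum Q xs ⟨
  count Q xs                    ∎
  where open ≡-Reasoning

count-splitBy : ∀ (P Q R : A → Bool) xs →
  count (λ x → P x ∧ R x) xs
    ≡ count (λ x → P x ∧ (Q x ∧ R x)) xs + count (λ x → (P x ∧ not (Q x)) ∧ R x) xs
count-splitBy P Q R [] = refl
count-splitBy P Q R (x ∷ xs) with P x | Q x | R x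
... | false | _     | _     = count-splitBy P Q R xs
... | true  | true  | false = count-splitBy P Q R xs
... | true  | false | false = count-splitBy P Q R xs
... | true  | true  | true  = cong suc (count-splitBy P Q R xs)
... | true  | false | true  = trans (cong suc (count-splitBy P Q R xs)) (sym (+-suc _ _))

count≢0 : ∀ {P : A → Bool} {x xs} → x ∈ₗ xs → P x ≡ true → count P xs ≢ 0
count≢0 {P = P} {x} (here refl) Px with P x | Px
... | true | _ = λ ()
count≢0 {P = P} {xs = y ∷ _} (there x∈xs) Px with P y
... | true  = λ ()
... | false = count≢0 x∈xs Px

count≢0⇒∃ : ∀ (P : A → Bool) xs → count P xs ≢ 0 → ∃ λ x → P x ≡ true
count≢0⇒∃ P [] count≢0 = contradiction refl count≢0
count≢0⇒∃ P (x ∷ xs) count≢0 with P x in Px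
... | true  = x , Px
... | false = count≢0⇒∃ P xs count≢0

sum-map-concatMap : ∀ (T : B → ℕ) (g : A → List B) xs →
  sum (map T (concatMap g xs)) ≡ sum (map (λ x → sum (map T (g x))) xs)
sum-map-concatMap T g [] = refl
sum-map-concatMap T g (x ∷ xs) = begin
  sum (map T (g x ++ concatMap g xs))
    ≡⟨ cong sum (map-++ T (g x) _) ⟩
  sum (map T (g x) ++ map T (concatMap g xs))
    ≡⟨ sum-++ (map T (g x)) _ ⟩
  sum (map T (g x)) + sum (map T (concatMap g xs))
    ≡⟨ cong (sum (map T (g x)) +_) (sum-map-concatMap T g xs) ⟩
  sum (map T (g x)) + sum (map (λ x → sum (map T (g x))) xs) ∎
  where open ≡-Reasoning

sum-tabulate-0 : ∀ {T : Fin k → ℕ} → (∀ j → T j ≡ 0) → sum (List.tabulate T) ≡ 0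
sum-tabulate-0 {zero}  _   = refl
sum-tabulate-0 {suc k} T≡0 = cong₂ _+_ (T≡0 zero) (sum-tabulate-0 (T≡0 ∘ suc))

∈-allSubsets : (s : Subset k) → s ∈ₗ allSubsets k
∈-allSubsets []          = here refl
∈-allSubsets (false ∷ s) = ∈-concatMap⁺ _ (lose (∈-allSubsets s) (here refl))
∈-allSubsets (true  ∷ s) = ∈-concatMap⁺ _ (lose (∈-allSubsets s) (there (here refl)))

allFuns-complete : (g : Fin a → Fin b) → ∃ λ f → f ∈ₗ allFuns a b × f ≗ g
allFuns-complete {zero}  g = _ , here refl , λ ()
allFuns-complete {suc a} g with allFuns-complete (g ∘ suc)
... | f , f∈allFuns , f≗g∘suc =
  _ , ∈-concatMap⁺ _ (lose f∈allFuns (∈-map⁺ _ (∈-allFin (g zero))))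
    , λ { zero → refl ; (suc i) → f≗g∘suc i }

Extensional : ((Fin a → Fin b) → A) → Set
Extensional T = ∀ {f g} → f ≗ g → T f ≡ T g

sum-allFuns-suc : ∀ (T : (Fin (suc a) → Fin b) → ℕ) → Extensional T →
  sum (map T (allFuns (suc a) b))
    ≡ sum (map (λ f → sum (List.tabulate λ j → T (j Vector.∷ f))) (allFuns a b))
sum-allFuns-suc {a} {b} T T-ext =
  trans (sum-map-concatMap T _ (allFuns a b)) (cong sum (map-cong (λ f → cong sum
    (trans (sym (map-∘ (allFin b))) (trans (map-tabulate id _)
      (tabulate-cong λ j → T-ext λ { zero → refl ; (suc i) → refl }))))
    (allFuns a b)))

-- A subset as an injection into its ambient set

embed : (s : Subset k) → Fin ∣ s ∣ → Fin k
embed (true  ∷ s) zero    = zero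
embed (true  ∷ s) (suc j) = suc (embed s j)
embed (false ∷ s) j       = suc (embed s j)

embed-∈ : ∀ (s : Subset k) j → embed s j ∈ s
embed-∈ (true  ∷ s) zero    = here
embed-∈ (true  ∷ s) (suc j) = there (embed-∈ s j)
embed-∈ (false ∷ s) j       = there (embed-∈ s j)

embed-injective : (s : Subset k) → Injective _≡_ _≡_ (embed s)
embed-injective (true  ∷ s) {zero}  {zero}  _   = refl
embed-injective (true  ∷ s) {suc i} {suc j} eq  = cong suc (embed-injective s (suc-injective eq))
embed-injective (false ∷ s)                 eq  = embed-injective s (suc-injective eq)

embed-surjective : ∀ (s : Subset k) {x} → x ∈ s → ∃ λ j → embed s j ≡ x
embed-surjective (true  ∷ s) here         = zero , refl
embed-surjective (true  ∷ s) (there x∈s) = let j , eq = embed-surjective s x∈s in suc j , cong suc eq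
embed-surjective (false ∷ s) (there x∈s) = let j , eq = embed-surjective s x∈s in j , cong suc eq

sum-tabulate-embed : ∀ (s : Subset k) (T : Fin k → ℕ) → (∀ x → x ∉ s → T x ≡ 0) →
  sum (List.tabulate T) ≡ sum (List.tabulate (T ∘ embed s))
sum-tabulate-embed []          T T-vanishes = refl
sum-tabulate-embed (true  ∷ s) T T-vanishes =
  cong (T zero +_) (sum-tabulate-embed s (T ∘ suc) (λ x → T-vanishes (suc x) ∘ (_∘ drop-there)))
sum-tabulate-embed (false ∷ s) T T-vanishes =
  cong₂ _+_ (T-vanishes zero λ ())
            (sum-tabulate-embed s (T ∘ suc) (λ x → T-vanishes (suc x) ∘ (_∘ drop-there)))

sum-allFuns-embed : ∀ (s : Subset b) (T : (Fin a → Fin b) → ℕ) → Extensional T →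
  (∀ g i → g i ∉ s → T g ≡ 0) →
  sum (map (λ f → T (embed s ∘ f)) (allFuns a ∣ s ∣)) ≡ sum (map T (allFuns a b))
sum-allFuns-embed {a = zero}  s T T-ext _ = cong (_+ 0) (T-ext λ ())
sum-allFuns-embed {b} {suc a} s T T-ext T-vanishes = begin
  sum (map (λ f → T (embed s ∘ f)) (allFuns (suc a) ∣ s ∣))
    ≡⟨ sum-allFuns-suc (λ f → T (embed s ∘ f)) (λ f≗g → T-ext (cong (embed s) ∘ f≗g)) ⟩
  sum (map (λ f → sum (List.tabulate λ j → T (embed s ∘ (j Vector.∷ f)))) (allFuns a ∣ s ∣))
    ≡⟨ cong sum (map-cong (λ f → cong sum (tabulate-cong λ j → T-ext (embed-∘-∷ j f)))
                          (allFuns a ∣ s ∣)) ⟩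
  sum (map (λ f → sum (List.tabulate λ j → T (embed s j Vector.∷ embed s ∘ f)))
           (allFuns a ∣ s ∣))
    ≡⟨ cong sum (map-cong (λ f → sym (sum-tabulate-embed s _ λ x → T-vanishes _ zero))
                          (allFuns a ∣ s ∣)) ⟩
  sum (map (λ f → T′ (embed s ∘ f)) (allFuns a ∣ s ∣))
    ≡⟨ sum-allFuns-embed s T′ T′-ext T′-vanishes ⟩
  sum (map T′ (allFuns a b))
    ≡⟨ sum-allFuns-suc T T-ext ⟨
  sum (map T (allFuns (suc a) b)) ∎
  where
  open ≡-Reasoning
  T′ : (Fin a → Fin b) → ℕ
  T′ g = sum (List.tabulate λ j → T (j Vector.∷ g))
  T′-ext : Extensional T′
  T′-ext {g} {h} g≗h = cong sum (tabulate-cong λ j →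
    T-ext {j Vector.∷ g} {j Vector.∷ h} λ { zero → refl ; (suc i) → g≗h i })
  embed-∘-∷ : ∀ j (f : Fin a → Fin ∣ s ∣) →
    embed s ∘ (j Vector.∷ f) ≗ embed s j Vector.∷ embed s ∘ f
  embed-∘-∷ j f zero    = refl
  embed-∘-∷ j f (suc i) = refl
  T′-vanishes : ∀ g i → g i ∉ s → T′ g ≡ 0
  T′-vanishes g i gi∉s = sum-tabulate-0 λ j → T-vanishes (j Vector.∷ g) (suc i) gi∉s

anyFin-true⁻ : ∀ (p : Fin k → Bool) → anyFin p ≡ true → ∃ λ i → p i ≡ true
anyFin-true⁻ {suc k} p t with p zero in p0
... | true  = zero , p0
... | false = let i , pi = anyFin-true⁻ (p ∘ suc) t in suc i , pi

anyFin-true⁺ : ∀ (p : Fin k → Bool) i → p i ≡ true → anyFin p ≡ true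
anyFin-true⁺ p zero    pi rewrite pi = refl
anyFin-true⁺ p (suc i) pi with p zero
... | true  = refl
... | false = anyFin-true⁺ (p ∘ suc) i pi

∈-image⁻ : ∀ (h : Fin a → Fin b) e {y} → y ∈ image h e → ∃ λ x → x ∈ e × h x ≡ y
∈-image⁻ h e {y} y∈image
  with anyFin-true⁻ _ (trans (sym (lookup∘tabulate _ y)) ([]=⇒lookup y∈image))
... | x , t = let x∈e , hx≡y = ∧-true⁻ t in x , lookup⇒[]= x e x∈e , ⌊⌋-true⁻ hx≡y

∈-image⁺ : ∀ (h : Fin a → Fin b) {e x} → x ∈ e → h x ∈ image h e
∈-image⁺ h {e} {x} x∈e = lookup⇒[]= (h x) (image h e)
  (trans (lookup∘tabulate _ (h x))
         (anyFin-true⁺ _ x (∧-true⁺ ([]=⇒lookup x∈e) (⌊⌋-true⁺ refl))))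

image-cong : ∀ {h h′ : Fin a → Fin b} → h ≗ h′ → ∀ e → image h e ≡ image h′ e
image-cong {h = h} {h′} h≗h′ e = ⊆-antisym (moved h≗h′) (moved (sym ∘ h≗h′))
  where
  moved : ∀ {f g} → f ≗ g → ∀ {y} → y ∈ image f e → y ∈ image g e
  moved {f} {g} f≗g y∈ with ∈-image⁻ f e y∈
  ... | x , x∈e , refl = subst (_∈ _) (sym (f≗g x)) (∈-image⁺ g x∈e)

image-∘ : ∀ {c} (g : Fin b → Fin c) (f : Fin a → Fin b) e →
  image g (image f e) ≡ image (g ∘ f) e
image-∘ g f e = ⊆-antisym ⊆ ⊇
  where
  ⊆ : ∀ {z} → z ∈ image g (image f e) → z ∈ image (g ∘ f) e
  ⊆ z∈ with ∈-image⁻ g (image f e) z∈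
  ... | y , y∈ , refl with ∈-image⁻ f e y∈
  ... | x , x∈e , refl = ∈-image⁺ (g ∘ f) x∈e
  ⊇ : ∀ {z} → z ∈ image (g ∘ f) e → z ∈ image g (image f e)
  ⊇ z∈ with ∈-image⁻ (g ∘ f) e z∈
  ... | x , x∈e , refl = ∈-image⁺ g (∈-image⁺ f x∈e)

image-≗id : ∀ {f : Fin a → Fin a} → f ≗ id → ∀ e → image f e ≡ e
image-≗id {f = f} f≗id e = ⊆-antisym ⊆ (λ x∈e → subst (_∈ _) (f≗id _) (∈-image⁺ f x∈e))
  where
  ⊆ : ∀ {y} → y ∈ image f e → y ∈ e
  ⊆ y∈ with ∈-image⁻ f e y∈
  ... | x , x∈e , refl = subst (_∈ e) (sym (f≗id x)) x∈e

image-injective : ∀ {h : Fin a → Fin b} → Injective _≡_ _≡_ h →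
  ∀ {e e′} → image h e ≡ image h e′ → e ≡ e′
image-injective {h = h} h-inj eq = ⊆-antisym (reflected eq) (reflected (sym eq))
  where
  reflected : ∀ {d d′} → image h d ≡ image h d′ → ∀ {x} → x ∈ d → x ∈ d′
  reflected {d′ = d′} eq x∈d with ∈-image⁻ h d′ (subst (_ ∈_) eq (∈-image⁺ h x∈d))
  ... | x′ , x′∈d′ , hx′≡hx = subst (_∈ _) (h-inj hx′≡hx) x′∈d′


preimage : (Fin a → Fin b) → Subset b → Subset a
preimage ι c = tabulate (λ x → lookup c (ι x))

∈-preimage⁺ : ∀ (ι : Fin a → Fin b) {c x} → ι x ∈ c → x ∈ preimage ι c
∈-preimage⁺ ι {c} {x} ιx∈c = lookup⇒[]= x _ (trans (lookup∘tabulate _ x) ([]=⇒lookup ιx∈c))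

image-preimage : ∀ (ι : Fin a → Fin b) {c} → (∀ {y} → y ∈ c → ∃ λ x → ι x ≡ y) →
  image ι (preimage ι c) ≡ c
image-preimage ι {c} covered = ⊆-antisym ⊆ ⊇
  where
  ⊆ : ∀ {y} → y ∈ image ι (preimage ι c) → y ∈ c
  ⊆ y∈ with ∈-image⁻ ι (preimage ι c) y∈
  ... | x , x∈ , refl = lookup⇒[]= (ι x) c (trans (sym (lookup∘tabulate _ x)) ([]=⇒lookup x∈))
  ⊇ : ∀ {y} → y ∈ c → y ∈ image ι (preimage ι c)
  ⊇ y∈c with covered y∈c
  ... | x , refl = ∈-image⁺ ι (∈-preimage⁺ ι y∈c)

nonempty⇒∣p∣≢0 : ∀ {p : Subset k} {x} → x ∈ p → ∣ p ∣ ≢ 0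
nonempty⇒∣p∣≢0 here ()
nonempty⇒∣p∣≢0 {p = true  ∷ _} (there _) ()
nonempty⇒∣p∣≢0 {p = false ∷ _} (there x∈p) = nonempty⇒∣p∣≢0 x∈p

∣image∣≡0 : ∀ (h : Fin a → Fin b) {e} → ∣ e ∣ ≡ 0 → ∣ image h e ∣ ≡ 0
∣image∣≡0 {b = b} h {e} ∣e∣≡0 = begin
  ∣ image h e ∣  ≡⟨ cong ∣_∣ (Empty-unique empty) ⟩
  ∣ ⊥ {b} ∣      ≡⟨ ∣⊥∣≡0 b ⟩
  0              ∎
  where
  open ≡-Reasoning
  empty : Empty (image h e)
  empty (y , y∈image) =
    let x , x∈e , _ = ∈-image⁻ h e y∈image in nonempty⇒∣p∣≢0 x∈e ∣e∣≡0

isHomᵇ⇒IsHom : ∀ {S G h} → isHomᵇ S G h ≡ true → IsHom S G h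
isHomᵇ⇒IsHom {S} t e Ee = not∨-true⁻ (allᵇ-true⁻ t (∈-allSubsets e)) Ee

IsHom⇒isHomᵇ : ∀ {S G h} → IsHom S G h → isHomᵇ S G h ≡ true
IsHom⇒isHomᵇ {S} hom = allᵇ-true⁺ (allSubsets (n S)) (λ {e} _ → not∨-true⁺ (hom e))

isHomᵇ-cong : ∀ S G {h h′} → h ≗ h′ → isHomᵇ S G h ≡ isHomᵇ S G h′
isHomᵇ-cong S G h≗h′ =
  allᵇ-cong (λ e → cong (λ t → not (E S e) ∨ E G t) (image-cong h≗h′ e)) (allSubsets (n S))

restrict : (G : Hypergraph) → (Subset (n G) → Bool) → Hypergraph
restrict G A = record { n = n G ; E = A }

_⊆ᴱ_ : (Subset k → Bool) → (Subset k → Bool) → Set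
A ⊆ᴱ A′ = ∀ t → A t ≡ true → A′ t ≡ true

restrict-wellformed : ∀ {G A} → Wellformed G → A ⊆ᴱ E G → Wellformed (restrict G A)
restrict-wellformed wf A⊆E e Ae = wf e (A⊆E e Ae)

subHypergraph-restrict : ∀ {X G A} → A ⊆ᴱ E G →
  SubHypergraph X (restrict G A) → SubHypergraph X G
subHypergraph-restrict A⊆E (wf , noIsolated , φ , φ-injective , φ-hom) =
  wf , noIsolated , φ , φ-injective , λ e Ee → A⊆E _ (φ-hom e Ee)

support : (G : Hypergraph) → Subset (n G)
support G = tabulate λ v → any (λ e → E G e ∧ lookup e v) (allSubsets (n G))

∈-support⁻ : ∀ {G v} → v ∈ support G → ∃ λ e → IsEdge G e × v ∈ e
∈-support⁻ {G} {v} v∈support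
  with any-true⁻ _ (allSubsets (n G))
                  (trans (sym (lookup∘tabulate _ v)) ([]=⇒lookup v∈support))
... | e , t = let Ee , v∈e = ∧-true⁻ t in e , Ee , lookup⇒[]= v e v∈e

∈-support⁺ : ∀ {G e v} → IsEdge G e → v ∈ e → v ∈ support G
∈-support⁺ {G} {e} {v} Ee v∈e = lookup⇒[]= v (support G)
  (trans (lookup∘tabulate _ v) (any-true⁺ _ (∈-allSubsets e) (∧-true⁺ Ee ([]=⇒lookup v∈e))))

hom⇒∈support : ∀ {S G h} → NoIsolated S → IsHom S G h → ∀ i → h i ∈ support G
hom⇒∈support {h = h} noIsolated hom i =
  let e , Ee , i∈e = noIsolated i in ∈-support⁺ (hom e Ee) (∈-image⁺ h i∈e)

-- The sub-hypergraph G[A] is core (restrict G A): its vertices are those covered by A,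
-- re-indexed by Fin ∣ support ∣ through embed.
core : Hypergraph → Hypergraph
core G = record { n = ∣ support G ∣ ; E = E G ∘ image (embed (support G)) }

core-wellformed : ∀ {G} → Wellformed G → Wellformed (core G)
core-wellformed {G} wf t Et = wf _ Et ∘ ∣image∣≡0 (embed (support G)) {t}

core-noIsolated : ∀ G → NoIsolated (core G)
core-noIsolated G j with ∈-support⁻ (embed-∈ (support G) j)
... | e , Ee , j∈e =
  preimage ι e , subst (IsEdge G) (sym (image-preimage ι covered)) Ee , ∈-preimage⁺ ι j∈e
  where
  ι = embed (support G)
  covered : ∀ {v} → v ∈ e → ∃ λ x → ι x ≡ v
  covered v∈e = embed-surjective (support G) (∈-support⁺ Ee v∈e)

core-subHypergraph : ∀ {G} → Wellformed G → SubHypergraph (core G) G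
core-subHypergraph {G} wf = core-wellformed wf , core-noIsolated G
                           , embed (support G) , embed-injective (support G) , λ t Et → Et

homCount-core : ∀ {S} G → NoIsolated S → homCount S (core G) ≡ homCount S G
homCount-core {S} G noIsolated = begin
  homCount S (core G)
    ≡⟨ count-cong isHomᵇ-core (allFuns (n S) ∣ U ∣) ⟩
  count (λ f → isHomᵇ S G (ι ∘ f)) (allFuns (n S) ∣ U ∣)
    ≡⟨ count≡sum _ (allFuns (n S) ∣ U ∣) ⟩
  sum (map (λ f → indicator (isHomᵇ S G (ι ∘ f))) (allFuns (n S) ∣ U ∣))
    ≡⟨ sum-allFuns-embed U (indicator ∘ isHomᵇ S G) (cong indicator ∘ isHomᵇ-cong S G) vanish ⟩
  sum (map (indicator ∘ isHomᵇ S G) (allFuns (n S) (n G)))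
    ≡⟨ count≡sum (isHomᵇ S G) (allFuns (n S) (n G)) ⟨
  homCount S G ∎
  where
  open ≡-Reasoning
  U = support G
  ι = embed U
  isHomᵇ-core : ∀ f → isHomᵇ S (core G) f ≡ isHomᵇ S G (ι ∘ f)
  isHomᵇ-core f =
    allᵇ-cong (λ e → cong (λ t → not (E S e) ∨ E G t) (image-∘ ι f e)) (allSubsets (n S))
  vanish : ∀ g i → g i ∉ U → indicator (isHomᵇ S G g) ≡ 0
  vanish g i gi∉U with isHomᵇ S G g in hom
  ... | false = refl
  ... | true  = contradiction (hom⇒∈support noIsolated (isHomᵇ⇒IsHom {S} {G} hom) i) gi∉U

-- Inclusion–exclusion over hyperedges

_≟ˢ_ : (s t : Subset k) → Dec (s ≡ t)
_≟ˢ_ = ≡-dec Bool._≟_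

_without_ : (Subset k → Bool) → Subset k → (Subset k → Bool)
(A without c) t = A t ∧ not ⌊ t ≟ˢ c ⌋

covers : (S : Hypergraph) → (Fin (n S) → Fin k) → Subset k → Bool
covers S h c = any (λ e → E S e ∧ ⌊ image h e ≟ˢ c ⌋) (allSubsets (n S))

covers-true⁻ : ∀ S {h : Fin (n S) → Fin k} {c} → covers S h c ≡ true →
  ∃ λ e → IsEdge S e × image h e ≡ c
covers-true⁻ S t with any-true⁻ _ (allSubsets (n S)) t
... | e , t′ = let Ee , he≡c = ∧-true⁻ t′ in e , Ee , ⌊⌋-true⁻ he≡c

covers-true⁺ : ∀ S {h : Fin (n S) → Fin k} {e c} → IsEdge S e → image h e ≡ c →
  covers S h c ≡ true
covers-true⁺ S {e = e} Ee he≡c =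
  any-true⁺ _ (∈-allSubsets e) (∧-true⁺ Ee (⌊⌋-true⁺ he≡c))

isHomᵇ-without : ∀ S G A c h →
  isHomᵇ S (restrict G (A without c)) h ≡ isHomᵇ S (restrict G A) h ∧ not (covers S h c)
isHomᵇ-without S G A c h =
  allᵇ-guarded-∧-not (E S) (A ∘ image h) (λ e → ⌊ image h e ≟ˢ c ⌋) (allSubsets (n S))

coverCount : (S G : Hypergraph) → (Subset (n G) → Bool) → List (Subset (n G)) → ℕ
coverCount S G A C =
  count (λ h → isHomᵇ S (restrict G A) h ∧ allᵇ (covers S h) C) (allFuns (n S) (n G))

coverCount-[] : ∀ S G A → coverCount S G A [] ≡ homCount S (restrict G A)
coverCount-[] S G A = count-cong (λ h → ∧-identityʳ _) (allFuns (n S) (n G))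

coverCount-∷ : ∀ S G A c C →
  coverCount S G A C ≡ coverCount S G A (c ∷ C) + coverCount S G (A without c) C
coverCount-∷ S G A c C =
  trans (count-splitBy (isHomᵇ S (restrict G A)) (λ h → covers S h c)
                       (λ h → allᵇ (covers S h) C) (allFuns (n S) (n G)))
        (cong (coverCount S G A (c ∷ C) +_)
              (count-cong (λ h → cong (_∧ allᵇ (covers S h) C) (sym (isHomᵇ-without S G A c h)))
                          (allFuns (n S) (n G))))

Distinguishes : (F H X : Hypergraph) → Set
Distinguishes F H X = homCount F X ≢ homCount H X

distinguishing⊎coverCount≡ : ∀ F H G → NoIsolated F → NoIsolated H → Wellformed G →
  ∀ C A → A ⊆ᴱ E G →
  (∃ λ X → SubHypergraph X G × Distinguishes F H X) ⊎ coverCount F G A C ≡ coverCount H G A C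
distinguishing⊎coverCount≡ F H G noF noH wf [] A A⊆E
  with homCount F (core (restrict G A)) ℕ.≟ homCount H (core (restrict G A))
... | no  distinct = inj₁ (core (restrict G A) ,
        subHypergraph-restrict A⊆E (core-subHypergraph (restrict-wellformed wf A⊆E)) , distinct)
... | yes equal    = inj₂ (begin
  coverCount F G A []               ≡⟨ coverCount-[] F G A ⟩
  homCount F (restrict G A)         ≡⟨ homCount-core (restrict G A) noF ⟨
  homCount F (core (restrict G A))  ≡⟨ equal ⟩
  homCount H (core (restrict G A))  ≡⟨ homCount-core (restrict G A) noH ⟩
  homCount H (restrict G A)         ≡⟨ coverCount-[] H G A ⟨
  coverCount H G A []               ∎)
  where open ≡-Reasoning
distinguishing⊎coverCount≡ F H G noF noH wf (c ∷ C) A A⊆E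
  with distinguishing⊎coverCount≡ F H G noF noH wf C A A⊆E
     | distinguishing⊎coverCount≡ F H G noF noH wf C (A without c)
                                  (λ t → A⊆E t ∘ proj₁ ∘ ∧-true⁻)
... | inj₁ distinguishing | _                    = inj₁ distinguishing
... | inj₂ _              | inj₁ distinguishing  = inj₁ distinguishing
... | inj₂ all≡           | inj₂ without≡        = inj₂ (+-cancelʳ-≡ _ _ _ (begin
  coverCount F G A (c ∷ C) + coverCount F G (A without c) C  ≡⟨ coverCount-∷ F G A c C ⟨
  coverCount F G A C                                         ≡⟨ all≡ ⟩
  coverCount H G A C                                         ≡⟨ coverCount-∷ H G A c C ⟩
  coverCount H G A (c ∷ C) + coverCount H G (A without c) C  ≡⟨ cong (_ +_) without≡ ⟨
  coverCount H G A (c ∷ C) + coverCount F G (A without c) C  ∎))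
  where open ≡-Reasoning

-- Edge-surjective homomorphisms

EdgeSurjective : (S G : Hypergraph) → (Fin (n S) → Fin (n G)) → Set
EdgeSurjective S G h = IsHom S G h × (∀ c → IsEdge G c → ∃ λ e → IsEdge S e × image h e ≡ c)

edges : (G : Hypergraph) → List (Subset (n G))
edges G = filterᵇ (E G) (allSubsets (n G))

∈-edges⁺ : ∀ {G c} → IsEdge G c → c ∈ₗ edges G
∈-edges⁺ {G} {c} Ec = ∈-filter⁺ (Bool.T? ∘ E G) (∈-allSubsets c) (≡true⇒T Ec)

∈-edges⁻ : ∀ {G c} → c ∈ₗ edges G → IsEdge G c
∈-edges⁻ {G} c∈edges =
  T⇒≡true (proj₂ (∈-filter⁻ (Bool.T? ∘ E G) {xs = allSubsets (n G)} c∈edges))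

coverCount≢0⇒edgeSurjective : ∀ S G → coverCount S G (E G) (edges G) ≢ 0 →
  ∃ (EdgeSurjective S G)
coverCount≢0⇒edgeSurjective S G count≢0 with count≢0⇒∃ _ (allFuns (n S) (n G)) count≢0
... | h , t = let hom , covering = ∧-true⁻ t in
  h , isHomᵇ⇒IsHom {S} {G} hom
    , λ c Ec → covers-true⁻ S (allᵇ-true⁻ {p = covers S h} covering (∈-edges⁺ {G} Ec))

coverCount-self≢0 : ∀ G → coverCount G G (E G) (edges G) ≢ 0
coverCount-self≢0 G with allFuns-complete {n G} id
... | f , f∈allFuns , f≗id = count≢0 f∈allFuns (∧-true⁺ hom covering)
  where
  hom : isHomᵇ G G f ≡ true
  hom = IsHom⇒isHomᵇ {G} {G} λ e Ee → subst (IsEdge G) (sym (image-≗id f≗id e)) Ee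
  covering : allᵇ (covers G f) (edges G) ≡ true
  covering = allᵇ-true⁺ (edges G) λ c∈edges →
    covers-true⁺ G (∈-edges⁻ {G} c∈edges) (image-≗id f≗id _)

edgeSurjective : ∀ S G → coverCount G G (E G) (edges G) ≡ coverCount S G (E G) (edges G) →
  ∃ (EdgeSurjective S G)
edgeSurjective S G counts≡ = coverCount≢0⇒edgeSurjective S G (coverCount-self≢0 G ∘ trans counts≡)

edgeSurjective-∘ : ∀ {F G H g h} →
  EdgeSurjective F G g → EdgeSurjective G H h → EdgeSurjective F H (h ∘ g)
edgeSurjective-∘ {F} {G} {H} {g} {h} (g-hom , g-onto) (h-hom , h-onto) = hom , onto
  where
  hom : IsHom F H (h ∘ g)
  hom e Ee = subst (IsEdge H) (image-∘ h g e) (h-hom _ (g-hom e Ee))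
  onto : ∀ c → IsEdge H c → ∃ λ e → IsEdge F e × image (h ∘ g) e ≡ c
  onto c Ec with h-onto c Ec
  ... | d , Ed , hd≡c with g-onto d Ed
  ... | e , Ee , ge≡d =
    e , Ee , trans (sym (image-∘ h g e)) (trans (cong (image h) ge≡d) hd≡c)

edgeSurjective⇒surjective : ∀ {S G h} → NoIsolated G → EdgeSurjective S G h →
  ∀ w → ∃ λ v → h v ≡ w
edgeSurjective⇒surjective {h = h} noIsolated (_ , onto) w with noIsolated w
... | c , Ec , w∈c with onto c Ec
... | e , _ , refl = let v , _ , hv≡w = ∈-image⁻ h e w∈c in v , hv≡w

-- A right inverse s of k is injective and misses x or y whenever k x ≡ k y with x ≢ y,
-- so extending s by the missed point gives an injection Fin (suc m) → Fin m.
surjective⇒injective : ∀ (k : Fin m → Fin m) → (∀ y → ∃ λ x → k x ≡ y) →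
  Injective _≡_ _≡_ k
surjective⇒injective {m} k onto {x} {y} kx≡ky with x ≟ y
... | yes x≡y = x≡y
... | no  x≢y = contradiction (injective⇒≤ s⁺-injective) 1+n≰n
  where
  s : Fin m → Fin m
  s = proj₁ ∘ onto
  k∘s : ∀ v → k (s v) ≡ v
  k∘s = proj₂ ∘ onto
  s-injective : Injective _≡_ _≡_ s
  s-injective {u} {v} su≡sv = trans (sym (k∘s u)) (trans (cong k su≡sv) (k∘s v))
  hit⇒fixed : ∀ {v z} → s v ≡ z → s (k z) ≡ z
  hit⇒fixed {v} {z} sv≡z = subst (λ w → s w ≡ z) (trans (sym (k∘s v)) (cong k sv≡z)) sv≡z
  missed : ∃ λ z → ∀ v → s v ≢ z
  missed with s (k x) ≟ x
  ... | no  skx≢x = x , λ v sv≡x → skx≢x (hit⇒fixed sv≡x)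
  ... | yes skx≡x =
    y , λ v sv≡y → x≢y (trans (sym skx≡x) (trans (cong s kx≡ky) (hit⇒fixed sv≡y)))
  s⁺ : Fin (suc m) → Fin m
  s⁺ = proj₁ missed Vector.∷ s
  s⁺-injective : Injective _≡_ _≡_ s⁺
  s⁺-injective {zero}  {zero}  _    = refl
  s⁺-injective {zero}  {suc v} z≡sv = contradiction (sym z≡sv) (proj₂ missed v)
  s⁺-injective {suc u} {zero}  su≡z = contradiction su≡z (proj₂ missed u)
  s⁺-injective {suc u} {suc v} eq   = cong suc (s-injective eq)

edgeSurjective⇒isomorphic : ∀ {F H g h} → NoIsolated F → NoIsolated H →
  EdgeSurjective F H g → EdgeSurjective H F h → Isomorphic F H
edgeSurjective⇒isomorphic {F} {H} {g} {h} noF noH g-surj h-surj =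
  g , ψ , ψ∘g , g∘ψ , edges-preserved
  where
  g-onto = edgeSurjective⇒surjective noH g-surj
  ψ : Fin (n H) → Fin (n F)
  ψ = proj₁ ∘ g-onto
  g∘ψ : ∀ w → g (ψ w) ≡ w
  g∘ψ = proj₂ ∘ g-onto
  g-injective : Injective _≡_ _≡_ g
  g-injective gu≡gv = surjective⇒injective (h ∘ g)
    (edgeSurjective⇒surjective noF (edgeSurjective-∘ g-surj h-surj)) (cong h gu≡gv)
  ψ∘g : ∀ v → ψ (g v) ≡ v
  ψ∘g v = g-injective (g∘ψ (g v))
  edges-preserved : ∀ e → E F e ≡ E H (image g e)
  edges-preserved e = ⇔→≡ (mk⇔ (proj₁ g-surj e) reflected)
    where
    reflected : IsEdge H (image g e) → IsEdge F e
    reflected Ege with proj₂ g-surj _ Ege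
    ... | e₀ , Ee₀ , ge₀≡ge = subst (IsEdge F) (image-injective g-injective ge₀≡ge) Ee₀

uniform⇒wellformed : ∀ {r G} → 1 ≤ r → Uniform r G → Wellformed G
uniform⇒wellformed 1≤r uniform e Ee ∣e∣≡0 =
  contradiction (subst (1 ≤_) (trans (sym (uniform e Ee)) ∣e∣≡0) 1≤r) λ ()

proposition5p9 : (r : ℕ) → 2 ≤ r → (F H : Hypergraph)
    → Uniform r F → Uniform r H → NoIsolated F → NoIsolated H
    → ¬ Isomorphic F H
    → ∃ λ (X : Hypergraph) → (SubHypergraph X F ⊎ SubHypergraph X H)
        × homCount F X ≢ homCount H X
proposition5p9 r 2≤r F H uniformF uniformH noF noH F≇H
  with distinguishing⊎coverCount≡ F H F noF noH (uniform⇒wellformed (<⇒≤ 2≤r) uniformF)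
                                  (edges F) (E F) (λ _ → id)
     | distinguishing⊎coverCount≡ F H H noF noH (uniform⇒wellformed (<⇒≤ 2≤r) uniformH)
                                  (edges H) (E H) (λ _ → id)
... | inj₁ (X , X⊑F , distinguishes) | _ = X , inj₁ X⊑F , distinguishes
... | inj₂ _ | inj₁ (X , X⊑H , distinguishes) = X , inj₂ X⊑H , distinguishes
... | inj₂ countsIntoF | inj₂ countsIntoH =
  contradiction (edgeSurjective⇒isomorphic noF noH (proj₂ (edgeSurjective F H (sym countsIntoH)))
                                                   (proj₂ (edgeSurjective H F countsIntoF)))
                F≇H
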